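{- Let $Q: H(\bar x)\leftarrow\varphi$ be a binary $\mathsf{FO}^+$ query over a vocabulary $\sigma$ and let $\mathrm{Mat}$ be a relational-to-matrix schema encoding on $\sigma(Q)=\sigma\cup\{H\}$ such that $\mathrm{Mat}\vdash Q:\tau$. Then for every database $db$ over $\sigma$ consistent with $\mathrm{Mat}$: if $\bar x=(x_1,x_2)$ then $[\![Q]\!](db)(H)$ is zero outside $\{1,\dots,\tau(x_1)^{db}\}\times\{1,\dots,\tau(x_2)^{db}\}$ (i.e. consistent with dimension $\tau(x_1)^{db}\times\tau(x_2)^{db}$); and if $\bar x=(x)$ then $[\![Q]\!](db)(H)$ is consistent with both dimensions $\tau(x)^{db}\times 1$ and $1\times\tau(x)^{db}$.
   Context: Fix a commutative semiring $(K,\oplus,\odot,\mathbb{0},\mathbb{1})$ with $\mathbb{0}\neq\mathbb{1}$. A $K$-relation of arity $a$ is a function $(\mathbb{N}_{>0})^a\to K$ with finitely many non-$\mathbb{0}$ values. A vocabulary is a finite set of relation symbols (with arities) and constant symbols, always containing the constant $1$; a database $db$ maps constants $c$ to $c^{db}\in\mathbb{N}_{>0}$ (with $1^{db}=1$) and relation symbols to $K$-relations. $\mathsf{FO}^+$ formulas: $\varphi::=R(\bar x)\mid x\le c\mid\exists\bar y.\varphi\mid\varphi\wedge\varphi\mid\varphi\vee\varphi$ (disjuncts with equal free variables), with the standard semiring semantics ($R(\bar x)\mapsto R^{db}(\nu(\bar x))$, $x\le c\mapsto\mathbb{1}$ iff $\nu(x)\le c^{db}$ else $\mathbb{0}$,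 $\wedge\mapsto\odot$, $\vee\mapsto\oplus$, $\exists\mapsto\bigoplus$ over extensions). A query $H(\bar x)\leftarrow\varphi$ lists (possibly repeated) free variables of $\varphi$ covering all of them; its output $H(\bar d)$ is the value of $\varphi$ on $\bar x\mapsto\bar d$ if $\bar d$ respects repetitions, else $\mathbb{0}$. Binary: every relation symbol in body and head has arity at most 2. Matrix side: size symbols (including $1$), matrix symbols with types $(\alpha,\beta)$, matrix schemas. A relational-to-matrix schema encoding $\mathrm{Mat}$ on $\sigma$ is a bijection from $\sigma$ to a matrix schema mapping constants to size symbols with $\mathrm{Mat}(1)=1$, relation symbols to matrix symbols, unary relations to matrix symbols of type $(\alpha,1)$ or $(1,\alpha)$, and nullary relations to type $(1,1)$. A $K$-relation $R$ is consistent with dimension $m\times n$ if it is $\mathbb{0}$ outside entries $(i,j)$ with $i\le m,j\le n$ (for unary $R$ viewed as an $m\times 1$ or $1\times n$ vector: zero beyond the length; nullary always consistent with $1\times 1$). A database $db$ is consistent with $\mathrm{Mat}$ if for every relation symbol $R$ with $\mathrm{Mat}(R):(\mathrm{Mat}(c),\mathrm{Mat}(d))$, $R^{db}$ is consistent with $c^{db}\times d^{db}$. For a size symbol $\alpha=\mathrm{Mat}(c)$, write $\alpha^{db}$ for $c^{db}$. Well-typedness: $\mathrm{Mat}\vdash\varphi:\tau$, for $\tau$ a map from free variables to size symbols, is defined by: $R(x_1,x_2):\{x_1\mapsto\alpha,x_2\mapsto\beta\}$ if $\mathrm{Mat}(R):(\alpha,\beta)$; $R(x):\{x\mapsto\alpha\}$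 if $\mathrm{Mat}(R)$ has type $(\alpha,1)$ or $(1,\alpha)$; $R():\{\}$ if type $(1,1)$; $x\le c:\{x\mapsto\mathrm{Mat}(c)\}$; $\exists\bar y.\varphi$ gets the restriction of $\varphi$'s typing to the remaining free variables; $\varphi_1\wedge\varphi_2$ and $\varphi_1\vee\varphi_2$ get $\tau_1\cup\tau_2$ provided $\tau_1,\tau_2$ agree on common variables. A binary query $Q:H(\bar x)\leftarrow\varphi$ is well-typed, $\mathrm{Mat}\vdash Q:\tau$, if $\mathrm{Mat}\vdash\varphi:\tau$ and either $\bar x=(x_1,x_2)$ and $\mathrm{Mat}(H)$ has type $(\tau(x_1),\tau(x_2))$, or $\bar x=(x)$ and $\mathrm{Mat}(H)$ has type $(\tau(x),1)$ or $(1,\tau(x))$. -}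

module Defs where

open import Level using (Level)
open import Data.Nat using (ℕ; zero; suc; _≤_; _<_; _≤?_; _⊔_)
import Data.Nat as ℕ
open import Data.Fin using (Fin; zero; suc)
import Data.Fin as Fin
import Data.Fin.Properties as FinP
open import Data.Vec using (Vec; []; _∷_; toList; lookup)
import Data.Vec as Vec
open import Data.Vec.Relation.Unary.Any using (Any)
open import Data.List using (List; []; _∷_; _++_; filter; deduplicate)
open import Data.List.Membership.Propositional using (_∈_; _∉_)
open import Data.List.Membership.DecPropositional ℕ._≟_ using (_∈?_)
open import Data.Maybe using (Maybe; just; nothing)
open import Data.Product using (_×_; _,_; proj₁; proj₂; ∃)
open import Data.Sum using (_⊎_)
open import Data.Unit using (⊤)
open import Data.Bool using (if_then_else_)
open import Relation.Nullary using (¬_; does; ¬?)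
open import Relation.Nullary.Decidable using (_→-dec_)
open import Relation.Binary.PropositionalEquality using (_≡_; _≢_; subst)
open import Function.Definitions using (Bijective)
open import Algebra.Bundles using (CommutativeSemiring)

-- Vocabularies.  Relation symbols are Fin nRel (with arities); constant
-- symbols are Fin (suc nConst), where the constant symbol `1` is `zero`.

record Vocab : Set where
  field
    nRel   : ℕ
    arity  : Fin nRel → ℕ
    nConst : ℕ

  RelSym : Set
  RelSym = Fin nRel

  Const : Set
  Const = Fin (suc nConst)

open Vocab public

oneC : (σ : Vocab) → Const σ
oneC σ = zero

-- σ ∪ {H}, where H is a fresh relation symbol of arity a; H is `zero`,
-- and the relation symbol R of σ becomes `suc R`.
extend : Vocab → ℕ → Vocab
extend σ a = record { nRel = suc (nRel σ) ; arity = ar ; nConst = nConst σ }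
  where
  ar : Fin (suc (nRel σ)) → ℕ
  ar zero    = a
  ar (suc R) = arity σ R

Hsym : (σ : Vocab) (a : ℕ) → RelSym (extend σ a)
Hsym σ a = zero

Var : Set
Var = ℕ

data Formula (σ : Vocab) : Set where
  rel  : (R : RelSym σ) → Vec Var (arity σ R) → Formula σ
  leq  : Var → Const σ → Formula σ
  ex   : List Var → Formula σ → Formula σ
  _∧ᶠ_ : Formula σ → Formula σ → Formula σ
  _∨ᶠ_ : Formula σ → Formula σ → Formula σ

fv : ∀ {σ} → Formula σ → List Var
fv (rel R xs) = toList xs
fv (leq x c)  = x ∷ []
fv (ex ys φ)  = filter (λ z → ¬? (z ∈? ys)) (fv φ)
fv (φ ∧ᶠ ψ)   = fv φ ++ fv ψ
fv (φ ∨ᶠ ψ)   = fv φ ++ fv ψ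

-- syntactic side condition of FO⁺: disjuncts have equal free variables
WF : ∀ {σ} → Formula σ → Set
WF (rel R xs) = ⊤
WF (leq x c)  = ⊤
WF (ex ys φ)  = WF φ
WF (φ ∧ᶠ ψ)   = WF φ × WF ψ
WF (φ ∨ᶠ ψ)   = WF φ × WF ψ × (∀ y → (y ∈ fv φ → y ∈ fv ψ) × (y ∈ fv ψ → y ∈ fv φ))

BinaryF : ∀ {σ} → Formula σ → Set
BinaryF {σ} (rel R xs) = arity σ R ≤ 2
BinaryF (leq x c)  = ⊤
BinaryF (ex ys φ)  = BinaryF φ
BinaryF (φ ∧ᶠ ψ)   = BinaryF φ × BinaryF ψ
BinaryF (φ ∨ᶠ ψ)   = BinaryF φ × BinaryF ψ

QueryWF : ∀ {σ a} → Vec Var a → Formula σ → Set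
QueryWF xs φ = WF φ × (∀ y → y ∈ toList xs → y ∈ fv φ) × (∀ y → y ∈ fv φ → y ∈ toList xs)

BinaryQ : ∀ {σ a} → Vec Var a → Formula σ → Set
BinaryQ {a = a} xs φ = a ≤ 2 × BinaryF φ

-- Matrix schemas: size symbols Fin (suc nSize) (size symbol `1` is zero),
-- matrix symbols Fin nMat each with a type (α , β).

record MatrixSchema : Set where
  field
    nSize : ℕ
    nMat  : ℕ
    mtype : Fin nMat → Fin (suc nSize) × Fin (suc nSize)

  Size : Set
  Size = Fin (suc nSize)

open MatrixSchema public

record Encoding (σ : Vocab) (S : MatrixSchema) : Set where
  field
    constMap  : Const σ → Size S
    constBij  : Bijective _≡_ _≡_ constMap
    constOne  : constMap zero ≡ zero
    relMap    : RelSym σ → Fin (nMat S)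
    relBij    : Bijective _≡_ _≡_ relMap
    unaryOK   : ∀ R → arity σ R ≡ 1 →
                  proj₂ (mtype S (relMap R)) ≡ zero ⊎ proj₁ (mtype S (relMap R)) ≡ zero
    nullaryOK : ∀ R → arity σ R ≡ 0 → mtype S (relMap R) ≡ (zero , zero)

  typeOf : RelSym σ → Size S × Size S
  typeOf R = mtype S (relMap R)

  constOf : Size S → Const σ
  constOf α = proj₁ (proj₂ constBij α)

open Encoding public

module Typing {σ : Vocab} {S : MatrixSchema}
              (relT : RelSym σ → Size S × Size S)
              (cM   : Const σ → Size S)
              where

  TEnv : Set
  TEnv = Var → Maybe (Size S)

  IsMap1 : TEnv → Var → Size S → Set
  IsMap1 τ x α = τ x ≡ just α × (∀ y → y ≢ x → τ y ≡ nothing)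

  -- τ = {x₁ ↦ α, x₂ ↦ β}  (forces α ≡ β when x₁ ≡ x₂)
  IsMap2 : TEnv → Var → Size S → Var → Size S → Set
  IsMap2 τ x₁ α x₂ β = τ x₁ ≡ just α × τ x₂ ≡ just β
                       × (∀ y → y ≢ x₁ → y ≢ x₂ → τ y ≡ nothing)

  IsEmpty : TEnv → Set
  IsEmpty τ = ∀ y → τ y ≡ nothing

  -- τ = τ₁ ∪ τ₂ (which forces τ₁, τ₂ to agree on common variables)
  IsUnion : TEnv → TEnv → TEnv → Set
  IsUnion τ τ₁ τ₂ = ∀ y α → (τ₁ y ≡ just α → τ y ≡ just α)
                          × (τ₂ y ≡ just α → τ y ≡ just α)
                          × (τ₁ y ≡ nothing → τ₂ y ≡ nothing → τ y ≡ nothing)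

  IsRestrict : TEnv → List Var → TEnv → Set
  IsRestrict τ ys τ' = ∀ y → (y ∈ ys → τ y ≡ nothing) × (y ∉ ys → τ y ≡ τ' y)

  data _⊢_ : Formula σ → TEnv → Set where
    rel2 : ∀ {R xs τ x₁ x₂ α β} (eq : arity σ R ≡ 2) →
           subst (Vec Var) eq xs ≡ x₁ ∷ x₂ ∷ [] →
           relT R ≡ (α , β) → IsMap2 τ x₁ α x₂ β → rel R xs ⊢ τ
    rel1 : ∀ {R xs τ x α} (eq : arity σ R ≡ 1) →
           subst (Vec Var) eq xs ≡ x ∷ [] →
           (relT R ≡ (α , zero) ⊎ relT R ≡ (zero , α)) → IsMap1 τ x α → rel R xs ⊢ τ
    rel0 : ∀ {R xs τ} (eq : arity σ R ≡ 0) →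
           relT R ≡ (zero , zero) → IsEmpty τ → rel R xs ⊢ τ
    tleq : ∀ {x c τ} → IsMap1 τ x (cM c) → leq x c ⊢ τ
    tex  : ∀ {ys φ τ τ'} → φ ⊢ τ' → IsRestrict τ ys τ' → ex ys φ ⊢ τ
    tand : ∀ {φ ψ τ τ₁ τ₂} → φ ⊢ τ₁ → ψ ⊢ τ₂ → IsUnion τ τ₁ τ₂ → (φ ∧ᶠ ψ) ⊢ τ
    tor  : ∀ {φ ψ τ τ₁ τ₂} → φ ⊢ τ₁ → ψ ⊢ τ₂ → IsUnion τ τ₁ τ₂ → (φ ∨ᶠ ψ) ⊢ τ

_⊢body_∶_ : ∀ {σ S a} → Encoding (extend σ a) S → Formula σ →
            (Var → Maybe (Size S)) → Set
_⊢body_∶_ {σ} {S} {a} E φ τ =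
  Typing._⊢_ {σ} {S} (λ R → typeOf E (suc R)) (constMap E) φ τ

module Semantics {c ℓ : Level} (K : CommutativeSemiring c ℓ) where
  open CommutativeSemiring K using (Carrier; _≈_; _+_; _*_; 0#; 1#)

  -- K-relation of arity a on ℕ_{>0}: a function with finite support,
  -- given constructively by a bound: zero on every tuple having an entry
  -- 0 (not in ℕ_{>0}) or an entry > bound.
  record KRel (a : ℕ) : Set (c Level.⊔ ℓ) where
    field
      val    : Vec ℕ a → Carrier
      bound  : ℕ
      finite : ∀ v → Any (λ i → i ≡ 0 ⊎ bound < i) v → val v ≈ 0#
  open KRel public

  NonTrivial : Set ℓ
  NonTrivial = ¬ (0# ≈ 1#)

  record DB (σ : Vocab) : Set (c Level.⊔ ℓ) where
    field
      cval : Const σ → ℕ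
      cpos : ∀ k → 1 ≤ cval k
      cone : cval zero ≡ 1
      rval : (R : RelSym σ) → KRel (arity σ R)
  open DB public

  maxFin : (n : ℕ) → (Fin n → ℕ) → ℕ
  maxFin zero    f = 0
  maxFin (suc n) f = f zero ⊔ maxFin n (λ i → f (suc i))

  -- an upper bound on the active domain of db (all constants and the
  -- supports of all relations lie in {1..dom db})
  dom : ∀ {σ} → DB σ → ℕ
  dom {σ} db = maxFin (suc (nConst σ)) (cval db) ⊔ maxFin (nRel σ) (λ R → bound (rval db R))

  sumTo : ℕ → (ℕ → Carrier) → Carrier
  sumTo zero    f = 0#
  sumTo (suc n) f = sumTo n f + f (suc n)

  _[_↦_] : (Var → ℕ) → Var → ℕ → (Var → ℕ)
  (ν [ y ↦ d ]) z = if does (z ℕ.≟ y) then d else ν z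

  -- ⊕ over all extensions of ν to the (distinct) variables ys
  sumExt : ℕ → List Var → ((Var → ℕ) → Carrier) → (Var → ℕ) → Carrier
  sumExt B []       f ν = f ν
  sumExt B (y ∷ ys) f ν = sumTo B (λ d → sumExt B ys f (ν [ y ↦ d ]))

  ⟦_⟧ : ∀ {σ} → Formula σ → DB σ → (Var → ℕ) → Carrier
  ⟦ rel R xs ⟧ db ν = val (rval db R) (Vec.map ν xs)
  ⟦ leq x k  ⟧ db ν = if does (ν x ≤? cval db k) then 1# else 0#
  ⟦ ex ys φ  ⟧ db ν =
    sumExt (dom db) (deduplicate ℕ._≟_ (filter (_∈? fv φ) ys)) (⟦ φ ⟧ db) ν
  ⟦ φ ∧ᶠ ψ   ⟧ db ν = ⟦ φ ⟧ db ν * ⟦ ψ ⟧ db ν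
  ⟦ φ ∨ᶠ ψ   ⟧ db ν = ⟦ φ ⟧ db ν + ⟦ ψ ⟧ db ν

  -- the assignment x̄ ↦ d̄ (default value 1 on other variables, irrelevant)
  assign : ∀ {a} → Vec Var a → Vec ℕ a → Var → ℕ
  assign []       []       z = 1
  assign (x ∷ xs) (d ∷ ds) z = if does (x ℕ.≟ z) then d else assign xs ds z

  Respects : ∀ {a} → Vec Var a → Vec ℕ a → Set
  Respects xs ds = ∀ i j → lookup xs i ≡ lookup xs j → lookup ds i ≡ lookup ds j

  respects? : ∀ {a} (xs : Vec Var a) (ds : Vec ℕ a) → Relation.Nullary.Dec (Respects xs ds)
  respects? xs ds = FinP.all? (λ i → FinP.all? (λ j →
                      (lookup xs i ℕ.≟ lookup xs j) →-dec (lookup ds i ℕ.≟ lookup ds j)))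

  output : ∀ {σ a} → DB σ → Vec Var a → Formula σ → Vec ℕ a → Carrier
  output db xs φ ds = if does (respects? xs ds) then ⟦ φ ⟧ db (assign xs ds) else 0#

  ConsistentMat : (Vec ℕ 2 → Carrier) → ℕ → ℕ → Set ℓ
  ConsistentMat f m n = ∀ i j → 1 ≤ i → 1 ≤ j → (m < i ⊎ n < j) → f (i ∷ j ∷ []) ≈ 0#

  ConsistentCol : (Vec ℕ 1 → Carrier) → ℕ → Set ℓ
  ConsistentCol f m = ∀ i → 1 ≤ i → m < i → f (i ∷ []) ≈ 0#

  ConsistentRow : (Vec ℕ 1 → Carrier) → ℕ → Set ℓ
  ConsistentRow f n = ∀ j → 1 ≤ j → n < j → f (j ∷ []) ≈ 0#

  module _ {σ S a} (E : Encoding (extend σ a) S) (db : DB σ) where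
    sizeVal : Size S → ℕ
    sizeVal α = cval db (constOf E α)

    ConsistentK : (n : ℕ) → KRel n → Size S × Size S → Set ℓ
    ConsistentK 0 R t = Level.Lift ℓ ⊤
    ConsistentK 1 R (α , β) =
      if does (α Fin.≟ zero) then ConsistentRow (val R) (sizeVal β)
                              else ConsistentCol (val R) (sizeVal α)
    ConsistentK 2 R (α , β) = ConsistentMat (val R) (sizeVal α) (sizeVal β)
    ConsistentK (suc (suc (suc n))) R t = Level.Lift ℓ ⊤

    ConsistentDB : Set ℓ
    ConsistentDB = ∀ (R : RelSym σ) → ConsistentK (arity σ R) (rval db R) (typeOf E (suc R))

{-# OPTIONS --safe #-}
module Submission where

-- A typing τ of the body gives each free variable x a size symbol τ(x). By induction on the
-- typing derivation, the body evaluates to 𝟘 under any assignment sending x beyond τ(x)^db: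
-- an atom R(x̄) because db is consistent with Mat, an atom x ≤ c because Mat(c) = τ(x), a
-- conjunction because one factor vanishes, a disjunction because FO⁺ disjuncts have the same
-- free variables so both summands vanish, and ∃ȳ because a sum of zeros is zero. The output
-- of the query is this value at the head assignment, or 𝟘.

open import Defs
open import Data.Nat using (ℕ)
open import Data.Fin using (Fin; zero; suc)
open import Data.Vec using (Vec; []; _∷_)
open import Data.Maybe using (Maybe; just; nothing)
open import Data.Product using (_×_; _,_)
open import Data.Sum using (_⊎_)
open import Relation.Binary.PropositionalEquality using (_≡_)
open import Algebra.Bundles using (CommutativeSemiring)

open import Data.Bool using (if_then_else_)
open import Data.Empty using (⊥-elim)
import Data.Fin as Fin
import Data.Nat as ℕ
open import Data.List using (List; []; _∷_; _++_; filter; deduplicate)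
open import Data.List.Membership.DecPropositional ℕ._≟_ using (_∈?_)
open import Data.List.Membership.Propositional using (_∈_; _∉_)
open import Data.List.Membership.Propositional.Properties
  using (∈-filter⁺; ∈-filter⁻; ∈-deduplicate⁻; ∈-++⁻; ∈-++⁺ˡ; ∈-++⁺ʳ)
open import Data.List.Relation.Unary.Any using (here; there)
open import Data.Maybe.Properties using (just-injective)
open import Data.Nat using (_<_; _≤?_; s≤s; z≤n) renaming (zero to zeroℕ; suc to sucℕ)
open import Data.Nat.Properties using (<⇒≱)
open import Data.Product using (∃; proj₁; proj₂)
open import Data.Sum using (inj₁; inj₂)
import Data.Sum as Sum
open import Data.Vec using (toList)
import Data.Vec as Vec
open import Data.Vec.Relation.Unary.Any using (here; there)
open import Function using (_∘_)
open import Relation.Binary.PropositionalEquality using (refl; sym; trans; cong; subst; _≢_)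
open import Relation.Nullary using (Dec; yes; no; does; ¬?)
open import Relation.Nullary.Decidable using (dec-true; dec-false)

toList-subst : ∀ {A : Set} {m n} (eq : m ≡ n) {xs : Vec A m} {ys : Vec A n} →
               subst (Vec A) eq xs ≡ ys → toList xs ≡ toList ys
toList-subst refl refl = refl

toList-empty : ∀ {A : Set} {n} (eq : n ≡ 0) (xs : Vec A n) → toList xs ≡ []
toList-empty refl [] = refl

just≢nothing : ∀ {A : Set} {m : Maybe A} {α} → m ≡ just α → m ≢ nothing
just≢nothing refl ()

∈-++-same⁻ : ∀ {A : Set} {xs ys : List A} {y} → (∀ z → (z ∈ xs → z ∈ ys) × (z ∈ ys → z ∈ xs)) →
             y ∈ xs ++ ys → y ∈ xs × y ∈ ys
∈-++-same⁻ {xs = xs} {y = y} same y∈ with ∈-++⁻ xs y∈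
... | inj₁ y∈xs = y∈xs , proj₁ (same y) y∈xs
... | inj₂ y∈ys = proj₂ (same y) y∈ys , y∈ys

module TypingProperties {σ : Vocab} {S : MatrixSchema}
                        (relT : RelSym σ → Size S × Size S) (cM : Const σ → Size S) where
  open Typing {σ} {S} relT cM

  IsMap1-just : ∀ {τ x′ α′ x α} → IsMap1 τ x′ α′ → τ x ≡ just α → x ≡ x′ × α ≡ α′
  IsMap1-just {x′ = x′} {x = x} (τx′ , rest) τx with x ℕ.≟ x′
  ... | yes refl = refl , just-injective (trans (sym τx) τx′)
  ... | no x≢x′  = ⊥-elim (just≢nothing τx (rest x x≢x′))

  IsMap2-just : ∀ {τ x₁ α₁ x₂ α₂ x α} → IsMap2 τ x₁ α₁ x₂ α₂ → τ x ≡ just α →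
                (x ≡ x₁ × α ≡ α₁) ⊎ (x ≡ x₂ × α ≡ α₂)
  IsMap2-just {x₁ = x₁} {x₂ = x₂} {x = x} (τx₁ , τx₂ , rest) τx with x ℕ.≟ x₁ | x ℕ.≟ x₂
  ... | yes refl | _        = inj₁ (refl , just-injective (trans (sym τx) τx₁))
  ... | no _     | yes refl = inj₂ (refl , just-injective (trans (sym τx) τx₂))
  ... | no x≢x₁  | no x≢x₂  = ⊥-elim (just≢nothing τx (rest x x≢x₁ x≢x₂))

  IsUnion-agreeˡ : ∀ {τ τ₁ τ₂ y α} → IsUnion τ τ₁ τ₂ → τ y ≡ just α →
                   (∃ λ β → τ₁ y ≡ just β) → τ₁ y ≡ just α
  IsUnion-agreeˡ u τy (_ , τ₁y) =
    trans τ₁y (cong just (just-injective (trans (sym (proj₁ (u _ _) τ₁y)) τy)))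

  IsUnion-agreeʳ : ∀ {τ τ₁ τ₂ y α} → IsUnion τ τ₁ τ₂ → τ y ≡ just α →
                   (∃ λ β → τ₂ y ≡ just β) → τ₂ y ≡ just α
  IsUnion-agreeʳ u τy (_ , τ₂y) =
    trans τ₂y (cong just (just-injective (trans (sym (proj₁ (proj₂ (u _ _)) τ₂y)) τy)))

  IsUnion-just : ∀ {τ τ₁ τ₂ y α} → IsUnion τ τ₁ τ₂ → τ y ≡ just α →
                 τ₁ y ≡ just α ⊎ τ₂ y ≡ just α
  IsUnion-just {τ₁ = τ₁} {τ₂} {y} {α} u τy with τ₁ y in τ₁y | τ₂ y in τ₂y
  ... | just α₁ | _       = inj₁ (trans (sym τ₁y) (IsUnion-agreeˡ u τy (α₁ , τ₁y)))
  ... | nothing | just α₂ = inj₂ (trans (sym τ₂y) (IsUnion-agreeʳ u τy (α₂ , τ₂y)))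
  ... | nothing | nothing = ⊥-elim (just≢nothing τy (proj₂ (proj₂ (u y α)) τ₁y τ₂y))

  IsUnion-typed : ∀ {τ τ₁ τ₂ y} → IsUnion τ τ₁ τ₂ →
                  (∃ λ α → τ₁ y ≡ just α) ⊎ (∃ λ α → τ₂ y ≡ just α) → ∃ λ α → τ y ≡ just α
  IsUnion-typed {y = y} u (inj₁ (α , τ₁y)) = α , proj₁ (u y α) τ₁y
  IsUnion-typed {y = y} u (inj₂ (α , τ₂y)) = α , proj₁ (proj₂ (u y α)) τ₂y

  fv⇒typed : ∀ {φ τ y} → φ ⊢ τ → y ∈ fv φ → ∃ λ α → τ y ≡ just α
  fv⇒typed (rel2 {α = α} {β} eq xs≡ _ (τx₁ , τx₂ , _)) y∈
    rewrite toList-subst eq xs≡ with y∈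
  ... | here refl         = α , τx₁
  ... | there (here refl) = β , τx₂
  fv⇒typed (rel1 {α = α} eq xs≡ _ (τx , _)) y∈ rewrite toList-subst eq xs≡ with y∈
  ... | here refl = α , τx
  fv⇒typed (rel0 {xs = xs} eq _ _) y∈ rewrite toList-empty eq xs with y∈
  ... | ()
  fv⇒typed (tleq (τx , _)) (here refl) = _ , τx
  fv⇒typed {y = y} (tex {ys = ys} {φ} ⊢φ r) y∈ =
    let y∈φ , y∉ys = ∈-filter⁻ (λ z → ¬? (z ∈? ys)) {xs = fv φ} y∈
        α , τ′y = fv⇒typed ⊢φ y∈φ
    in α , trans (proj₂ (r y) y∉ys) τ′y
  fv⇒typed (tand {φ = φ} ⊢φ ⊢ψ u) y∈ =
    IsUnion-typed u (Sum.map (fv⇒typed ⊢φ) (fv⇒typed ⊢ψ) (∈-++⁻ (fv φ) y∈))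
  fv⇒typed (tor  {φ = φ} ⊢φ ⊢ψ u) y∈ =
    IsUnion-typed u (Sum.map (fv⇒typed ⊢φ) (fv⇒typed ⊢ψ) (∈-++⁻ (fv φ) y∈))

  typed⇒fv : ∀ {φ τ y α} → φ ⊢ τ → τ y ≡ just α → y ∈ fv φ
  typed⇒fv (rel2 eq xs≡ _ τ≗) τy rewrite toList-subst eq xs≡ with IsMap2-just τ≗ τy
  ... | inj₁ (refl , _) = here refl
  ... | inj₂ (refl , _) = there (here refl)
  typed⇒fv (rel1 eq xs≡ _ τ≗) τy rewrite toList-subst eq xs≡ with IsMap1-just τ≗ τy
  ... | refl , _ = here refl
  typed⇒fv {y = y} (rel0 _ _ τ≗) τy = ⊥-elim (just≢nothing τy (τ≗ y))
  typed⇒fv (tleq τ≗) τy with IsMap1-just τ≗ τy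
  ... | refl , _ = here refl
  typed⇒fv {y = y} (tex {ys = ys} ⊢φ r) τy with y ∈? ys
  ... | yes y∈ys = ⊥-elim (just≢nothing τy (proj₁ (r y) y∈ys))
  ... | no y∉ys  =
    ∈-filter⁺ (λ z → ¬? (z ∈? ys)) (typed⇒fv ⊢φ (trans (sym (proj₂ (r y) y∉ys)) τy)) y∉ys
  typed⇒fv (tand {φ = φ} ⊢φ ⊢ψ u) τy =
    Sum.[ ∈-++⁺ˡ ∘ typed⇒fv ⊢φ , ∈-++⁺ʳ (fv φ) ∘ typed⇒fv ⊢ψ ] (IsUnion-just u τy)
  typed⇒fv (tor  {φ = φ} ⊢φ ⊢ψ u) τy =
    Sum.[ ∈-++⁺ˡ ∘ typed⇒fv ⊢φ , ∈-++⁺ʳ (fv φ) ∘ typed⇒fv ⊢ψ ] (IsUnion-just u τy)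

module SupportBounds {c ℓ} (K : CommutativeSemiring c ℓ) where
  open Semantics K
  open CommutativeSemiring K
    using (Carrier; _≈_; 0#; _+_; _*_; +-cong; +-identityˡ; *-congʳ; *-congˡ; zeroˡ; zeroʳ)
    renaming (refl to ≈-refl; trans to ≈-trans)

  assign-head : ∀ {n} x (xs : Vec Var n) d ds → assign (x ∷ xs) (d ∷ ds) x ≡ d
  assign-head x xs d ds rewrite dec-true (x ℕ.≟ x) refl = refl

  assign-second : ∀ x₁ x₂ d₁ d₂ → Respects (x₁ ∷ x₂ ∷ []) (d₁ ∷ d₂ ∷ []) →
                  assign (x₁ ∷ x₂ ∷ []) (d₁ ∷ d₂ ∷ []) x₂ ≡ d₂
  assign-second x₁ x₂ d₁ d₂ resp with x₁ ℕ.≟ x₂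
  ... | yes x₁≡x₂ rewrite dec-true (x₁ ℕ.≟ x₂) x₁≡x₂ = resp zero (suc zero) x₁≡x₂
  ... | no x₁≢x₂  rewrite dec-false (x₁ ℕ.≟ x₂) x₁≢x₂ = assign-head x₂ [] d₂ []

  ZeroBeyond : ((Var → ℕ) → Carrier) → Var → ℕ → Set ℓ
  ZeroBeyond f x n = ∀ ν → n < ν x → f ν ≈ 0#

  sumTo-zero : ∀ n {f : ℕ → Carrier} → (∀ d → f d ≈ 0#) → sumTo n f ≈ 0#
  sumTo-zero zeroℕ    f≈0 = ≈-refl
  sumTo-zero (sucℕ n) f≈0 = ≈-trans (+-cong (sumTo-zero n f≈0) (f≈0 (sucℕ n))) (+-identityˡ 0#)

  update-other : ∀ (ν : Var → ℕ) {x y} d → x ≢ y → (ν [ y ↦ d ]) x ≡ ν x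
  update-other ν {x} {y} d x≢y rewrite dec-false (x ℕ.≟ y) x≢y = refl

  sumExt-zeroBeyond : ∀ B zs {f : (Var → ℕ) → Carrier} {x n} → x ∉ zs →
                      ZeroBeyond f x n → ZeroBeyond (sumExt B zs f) x n
  sumExt-zeroBeyond B []       x∉ f0 = f0
  sumExt-zeroBeyond B (y ∷ ys) {n = n} x∉ f0 ν n<νx = sumTo-zero B λ d →
    sumExt-zeroBeyond B ys (x∉ ∘ there) f0 (ν [ y ↦ d ])
      (subst (n <_) (sym (update-other ν d (x∉ ∘ here))) n<νx)

  +-zeroBeyond : ∀ {f g : (Var → ℕ) → Carrier} {x n} → ZeroBeyond f x n → ZeroBeyond g x n →
                 ZeroBeyond (λ ν → f ν + g ν) x n
  +-zeroBeyond f0 g0 ν h = ≈-trans (+-cong (f0 ν h) (g0 ν h)) (+-identityˡ 0#)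

  *-zeroBeyondˡ : ∀ {f g : (Var → ℕ) → Carrier} {x n} → ZeroBeyond f x n →
                  ZeroBeyond (λ ν → f ν * g ν) x n
  *-zeroBeyondˡ f0 ν h = ≈-trans (*-congʳ (f0 ν h)) (zeroˡ _)

  *-zeroBeyondʳ : ∀ {f g : (Var → ℕ) → Carrier} {x n} → ZeroBeyond g x n →
                  ZeroBeyond (λ ν → f ν * g ν) x n
  *-zeroBeyondʳ g0 ν h = ≈-trans (*-congˡ (g0 ν h)) (zeroʳ _)

  -- Entries with an index 0 vanish by finiteness, so positivity of the indices can be dropped.
  consistentMat-zero : ∀ {m n} (R : KRel 2) → ConsistentMat (val R) m n →
                       ∀ {i j} → m < i ⊎ n < j → val R (i ∷ j ∷ []) ≈ 0#
  consistentMat-zero R C {zeroℕ}           _ = finite R _ (here (inj₁ refl))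
  consistentMat-zero R C {sucℕ i} {zeroℕ}  _ = finite R _ (there (here (inj₁ refl)))
  consistentMat-zero R C {sucℕ i} {sucℕ j} h = C (sucℕ i) (sucℕ j) (s≤s z≤n) (s≤s z≤n) h

  consistentCol-zero : ∀ {m} (R : KRel 1) → ConsistentCol (val R) m →
                       ∀ {i} → m < i → val R (i ∷ []) ≈ 0#
  consistentCol-zero R C {zeroℕ}  _ = finite R _ (here (inj₁ refl))
  consistentCol-zero R C {sucℕ i} h = C (sucℕ i) (s≤s z≤n) h

  leq-zeroBeyond : ∀ {σ} (db : DB σ) x k → ZeroBeyond (⟦ leq x k ⟧ db) x (cval db k)
  leq-zeroBeyond db x k ν k<νx rewrite dec-false (ν x ≤? cval db k) (<⇒≱ k<νx) = ≈-refl

  module _ {σ S a} (E : Encoding (extend σ a) S) (db : DB σ) where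
    open Typing {σ} {S} (λ R → typeOf E (suc R)) (constMap E)
    open TypingProperties {σ} {S} (λ R → typeOf E (suc R)) (constMap E)

    sz : Size S → ℕ
    sz = sizeVal E db

    sizeVal-constMap : ∀ k → sz (constMap E k) ≡ cval db k
    sizeVal-constMap k =
      cong (cval db) (proj₁ (constBij E) (proj₂ (proj₂ (constBij E) (constMap E k)) refl))

    rel₂-zero : ∀ {n} (R : KRel n) (xs : Vec Var n) (eq : n ≡ 2) {x₁ x₂ t α β} →
                subst (Vec Var) eq xs ≡ x₁ ∷ x₂ ∷ [] → t ≡ (α , β) → ConsistentK E db n R t →
                ∀ ν → sz α < ν x₁ ⊎ sz β < ν x₂ → val R (Vec.map ν xs) ≈ 0#
    rel₂-zero R xs refl refl refl C ν = consistentMat-zero R C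

    -- ConsistentK reads the type (1, 1) as a row; its bound is then sz 1 = sz α either way.
    rel₁-zero : ∀ {n} (R : KRel n) (xs : Vec Var n) (eq : n ≡ 1) {x t α} →
                subst (Vec Var) eq xs ≡ x ∷ [] → (t ≡ (α , zero) ⊎ t ≡ (zero , α)) →
                ConsistentK E db n R t → ∀ ν → sz α < ν x → val R (Vec.map ν xs) ≈ 0#
    rel₁-zero R xs refl {α = α} refl (inj₁ refl) C ν with α Fin.≟ zero
    ... | yes refl = consistentCol-zero R C
    ... | no _     = consistentCol-zero R C
    rel₁-zero R xs refl refl (inj₂ refl) C ν = consistentCol-zero R C

    ⟦⟧-zeroBeyond : ConsistentDB E db → ∀ {φ τ x α} → φ ⊢ τ → WF φ → τ x ≡ just α →
                    ZeroBeyond (⟦ φ ⟧ db) x (sz α)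
    ⟦⟧-zeroBeyond cdb (rel2 {R = R} {xs} eq xs≡ tR τ≗) _ τx with IsMap2-just τ≗ τx
    ... | inj₁ (refl , refl) = λ ν → rel₂-zero (rval db R) xs eq xs≡ tR (cdb R) ν ∘ inj₁
    ... | inj₂ (refl , refl) = λ ν → rel₂-zero (rval db R) xs eq xs≡ tR (cdb R) ν ∘ inj₂
    ⟦⟧-zeroBeyond cdb (rel1 {R = R} {xs} eq xs≡ tR τ≗) _ τx with IsMap1-just τ≗ τx
    ... | refl , refl = rel₁-zero (rval db R) xs eq xs≡ tR (cdb R)
    ⟦⟧-zeroBeyond cdb (rel0 _ _ τ≗) _ τx = ⊥-elim (just≢nothing τx (τ≗ _))
    ⟦⟧-zeroBeyond cdb (tleq {x = x} {c = k} τ≗) _ τx with IsMap1-just τ≗ τx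
    ... | refl , refl = subst (ZeroBeyond _ x) (sym (sizeVal-constMap k)) (leq-zeroBeyond db x k)
    ⟦⟧-zeroBeyond cdb {x = x} (tex {ys = ys} {φ} ⊢φ r) wf τx with x ∈? ys
    ... | yes x∈ys = ⊥-elim (just≢nothing τx (proj₁ (r x) x∈ys))
    ... | no x∉ys  = sumExt-zeroBeyond (dom db) (deduplicate ℕ._≟_ (filter (_∈? fv φ) ys))
                       (x∉ys ∘ proj₁ ∘ ∈-filter⁻ (_∈? fv φ) {xs = ys} ∘ ∈-deduplicate⁻ ℕ._≟_ _)
                       (⟦⟧-zeroBeyond cdb ⊢φ wf (trans (sym (proj₂ (r x) x∉ys)) τx))
    ⟦⟧-zeroBeyond cdb (tand ⊢φ ⊢ψ u) (wf₁ , wf₂) τx with IsUnion-just u τx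
    ... | inj₁ τ₁x = *-zeroBeyondˡ (⟦⟧-zeroBeyond cdb ⊢φ wf₁ τ₁x)
    ... | inj₂ τ₂x = *-zeroBeyondʳ (⟦⟧-zeroBeyond cdb ⊢ψ wf₂ τ₂x)
    ⟦⟧-zeroBeyond cdb (tor ⊢φ ⊢ψ u) (wf₁ , wf₂ , same) τx =
      let x∈φ , x∈ψ = ∈-++-same⁻ same (typed⇒fv (tor ⊢φ ⊢ψ u) τx) in
      +-zeroBeyond (⟦⟧-zeroBeyond cdb ⊢φ wf₁ (IsUnion-agreeˡ u τx (fv⇒typed ⊢φ x∈φ)))
                   (⟦⟧-zeroBeyond cdb ⊢ψ wf₂ (IsUnion-agreeʳ u τx (fv⇒typed ⊢ψ x∈ψ)))

    output-zero : ∀ {n} (xs : Vec Var n) φ ds →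
                  (Respects xs ds → ⟦ φ ⟧ db (assign xs ds) ≈ 0#) → output db xs φ ds ≈ 0#
    output-zero xs φ ds = if-zero (respects? xs ds)
      where
      if-zero : ∀ {p} {P : Set p} (P? : Dec P) {u} → (P → u ≈ 0#) →
                (if does P? then u else 0#) ≈ 0#
      if-zero (yes p) u≈0 = u≈0 p
      if-zero (no _)  _   = ≈-refl

    output₂-consistent : ConsistentDB E db → ∀ {φ τ x₁ x₂ α β} → φ ⊢ τ → WF φ →
                         τ x₁ ≡ just α → τ x₂ ≡ just β →
                         ConsistentMat (output db (x₁ ∷ x₂ ∷ []) φ) (sz α) (sz β)
    output₂-consistent cdb {φ} {x₁ = x₁} {x₂} {α} {β} ⊢φ wf τx₁ τx₂ i j _ _ =
      output-zero (x₁ ∷ x₂ ∷ []) φ (i ∷ j ∷ []) ∘ beyond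
      where
      beyond : sz α < i ⊎ sz β < j → Respects (x₁ ∷ x₂ ∷ []) (i ∷ j ∷ []) →
               ⟦ φ ⟧ db (assign (x₁ ∷ x₂ ∷ []) (i ∷ j ∷ [])) ≈ 0#
      beyond (inj₁ α<i) _    =
        ⟦⟧-zeroBeyond cdb ⊢φ wf τx₁ _
          (subst (sz α <_) (sym (assign-head x₁ (x₂ ∷ []) i (j ∷ []))) α<i)
      beyond (inj₂ β<j) resp =
        ⟦⟧-zeroBeyond cdb ⊢φ wf τx₂ _
          (subst (sz β <_) (sym (assign-second x₁ x₂ i j resp)) β<j)

    output₁-consistent : ConsistentDB E db → ∀ {φ τ x α} → φ ⊢ τ → WF φ → τ x ≡ just α →
                         ConsistentCol (output db (x ∷ []) φ) (sz α)
    output₁-consistent cdb {φ} {x = x} ⊢φ wf τx i _ α<i =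
      output-zero (x ∷ []) φ (i ∷ []) λ _ →
        ⟦⟧-zeroBeyond cdb ⊢φ wf τx _ (subst (_ <_) (sym (assign-head x [] i [])) α<i)

open SupportBounds using (output₂-consistent; output₁-consistent)

proposition3 : ∀ {c ℓ} (K : CommutativeSemiring c ℓ) →
    let open Semantics K in
    NonTrivial →
    (σ : Vocab) (S : MatrixSchema) →
    -- case x̄ = (x₁ , x₂)
    (∀ (x₁ x₂ : Var) (φ : Formula σ) (E : Encoding (extend σ 2) S)
       (τ : Var → Maybe (Size S)) →
       BinaryQ (x₁ ∷ x₂ ∷ []) φ → QueryWF (x₁ ∷ x₂ ∷ []) φ →
       E ⊢body φ ∶ τ →
       ∀ α β → τ x₁ ≡ just α → τ x₂ ≡ just β →
       typeOf E (Hsym σ 2) ≡ (α , β) →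
       ∀ (db : DB σ) → ConsistentDB E db →
       ConsistentMat (output db (x₁ ∷ x₂ ∷ []) φ) (sizeVal E db α) (sizeVal E db β))
    ×
    -- case x̄ = (x)
    (∀ (x : Var) (φ : Formula σ) (E : Encoding (extend σ 1) S)
       (τ : Var → Maybe (Size S)) →
       BinaryQ (x ∷ []) φ → QueryWF (x ∷ []) φ →
       E ⊢body φ ∶ τ →
       ∀ α → τ x ≡ just α →
       (typeOf E (Hsym σ 1) ≡ (α , zero) ⊎ typeOf E (Hsym σ 1) ≡ (zero , α)) →
       ∀ (db : DB σ) → ConsistentDB E db →
       ConsistentCol (output db (x ∷ []) φ) (sizeVal E db α)
       × ConsistentRow (output db (x ∷ []) φ) (sizeVal E db α))
proposition3 K _ _ _ =
    (λ _ _ _ E _ _ (wf , _) ⊢φ _ _ τx₁ τx₂ _ db cdb →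
       output₂-consistent K E db cdb ⊢φ wf τx₁ τx₂)
  , (λ _ _ E _ _ (wf , _) ⊢φ _ τx _ db cdb →
       output₁-consistent K E db cdb ⊢φ wf τx , output₁-consistent K E db cdb ⊢φ wf τx)
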